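{- Let $\mathcal{P}$ be a vector space partition of $\mathrm{PG}(v-1,q)$ and let $k\ge 1$. Let $\mathcal{H}_k$ be the set of points $P$ such that the element $A\in\mathcal{P}$ containing $P$ has dimension at most $k$. If $\mathcal{P}$ contains an element of dimension strictly larger than $k$, then $\mathcal{H}_k$ is $q^k$-divisible.
   Context: Subspaces are described by vector space dimension. A vector space partition of $\mathrm{PG}(v-1,q)$ is a set of subspaces, each of dimension between $1$ and $v-1$, partitioning the set of points. A multiset of points $\chi$ (a map from points to $\mathbb{N}$; a set is identified with its characteristic function) is $\Delta$-divisible if $\sum_{P\not\le H}\chi(P)\equiv 0\pmod{\Delta}$ for every hyperplane $H$ of $\mathrm{PG}(v-1,q)$. -}

module Defs where

open import Level using (0ℓ)
open import Algebra.Bundles using (CommutativeRing)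
open import Data.Nat using (ℕ; zero; suc; _≤_; _<_; _∸_; _^_)
open import Data.Nat.Divisibility using (_∣_)
open import Data.Fin using (Fin)
open import Data.Vec using (Vec; []; _∷_; replicate; zipWith; map)
open import Data.List using (List; length)
open import Data.List.Membership.Propositional using (_∈_)
open import Data.List.Relation.Unary.Unique.Propositional using (Unique)
open import Data.Product using (Σ; ∃; _×_)
open import Relation.Nullary using (¬_)
open import Relation.Binary.PropositionalEquality using (_≡_)

record FiniteField : Set₁ where
  field
    cring : CommutativeRing 0ℓ 0ℓ
  open CommutativeRing cring public hiding (ring)
  field
    ≈⇒≡ : ∀ {x y} → x ≈ y → x ≡ y
    0≢1 : ¬ (0# ≡ 1#)
    inverse : ∀ x → ¬ (x ≡ 0#) → Σ Carrier λ y → x * y ≡ 1#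
    elems : List Carrier
    elems-complete : ∀ x → x ∈ elems
    elems-unique : Unique elems

  q : ℕ
  q = length elems

module Geometry (F : FiniteField) where
  open FiniteField F

  Vect : ℕ → Set
  Vect v = Vec Carrier v

  zeroV : ∀ {v} → Vect v
  zeroV = replicate _ 0#

  lincomb : ∀ {v d} → Vec Carrier d → Vec (Vect v) d → Vect v
  lincomb [] [] = zeroV
  lincomb (c ∷ cs) (b ∷ bs) = zipWith _+_ (map (c *_) b) (lincomb cs bs)

  LinIndep : ∀ {v d} → Vec (Vect v) d → Set
  LinIndep {v} {d} B = ∀ (c : Vec Carrier d) → lincomb c B ≡ zeroV → c ≡ replicate d 0#

  -- A subspace of F^v of (vector space) dimension `dim`, given by a basis.
  record Subspace (v : ℕ) : Set where
    field
      dim : ℕ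
      basis : Vec (Vect v) dim
      indep : LinIndep basis
  open Subspace public

  _∈S_ : ∀ {v} → Vect v → Subspace v → Set
  x ∈S S = Σ (Vec Carrier (dim S)) λ c → lincomb c (basis S) ≡ x

  -- Points of PG(v-1,q) are represented by their normalized coordinate
  -- vectors: nonzero, first nonzero coordinate equal to 1.
  data IsPoint : ∀ {n} → Vect n → Set where
    here  : ∀ {n} {xs : Vect n} → IsPoint (1# ∷ xs)
    there : ∀ {n} {xs : Vect n} → IsPoint xs → IsPoint (0# ∷ xs)

  IsHyperplane : ∀ {v} → Subspace v → Set
  IsHyperplane {v} H = dim H ≡ v ∸ 1

  record IsVSPartition {v n : ℕ} (𝒫 : Fin n → Subspace v) : Set where
    field
      dim-pos : ∀ i → 1 ≤ dim (𝒫 i)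
      dim-lt  : ∀ i → dim (𝒫 i) < v
      cover   : ∀ (P : Vect v) → IsPoint P → ∃ λ i → P ∈S 𝒫 i
      unique  : ∀ (P : Vect v) → IsPoint P → ∀ i j → P ∈S 𝒫 i → P ∈S 𝒫 j → i ≡ j

  InHk : ∀ {v n} → (Fin n → Subspace v) → ℕ → Vect v → Set
  InHk 𝒫 k P = IsPoint P × ∃ λ i → P ∈S 𝒫 i × dim (𝒫 i) ≤ k

  -- A set of points X (given as a predicate on normalized vectors) is
  -- Δ-divisible: for every hyperplane H, the number of points of X not in H
  -- is ≡ 0 mod Δ.  The count is the length of any duplicate-free list
  -- enumerating exactly those points.
  Divisible : ∀ {v} → ℕ → (Vect v → Set) → Set
  Divisible {v} Δ X =
    ∀ (H : Subspace v) → IsHyperplane H →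
    ∀ (L : List (Vect v)) → Unique L →
    (∀ P → (P ∈ L → IsPoint P × X P × ¬ (P ∈S H)) × (IsPoint P × X P × ¬ (P ∈S H) → P ∈ L)) →
    Δ ∣ length L

module Submission where

-- Count nonzero vectors of F^v instead of points: each point off a hyperplane H accounts for
-- exactly q - 1 of them.  Every nonzero vector lies in exactly one element of the partition, so
-- the q^v - q^(v-1) vectors outside H split into the vectors of 𝓗_k ∖ H and, for each element B
-- of dimension d > k, the |B| - |B ∩ H| vectors of B ∖ H.  A coset count shows that the index
-- [B : B ∩ H] divides [F^v : H] = q, so q^(d-1) divides |B ∩ H| and q^k divides |B ∖ H|.  Hence
-- q^k divides (q - 1) times the number of points of 𝓗_k off H, and q^k is coprime to q - 1.

open import Level using (0ℓ)
open import Algebra.Bundles using (AbelianGroup)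
open import Algebra.Structures using (IsAbelianGroup)
import Algebra.Properties.AbelianGroup as AbelianGroupProperties
import Algebra.Properties.CommutativeMonoid.Sum as Sum
import Algebra.Properties.CommutativeSemigroup as CommutativeSemigroupProperties
open import Data.Bool using (Bool; true; false; T; not; _∧_; _∨_)
open import Data.Bool.ListAction using (any)
import Data.Bool.Properties
open import Data.Bool.Properties using (T-∧; T-∨; ∧-zeroʳ; ∧-identityʳ)
open import Data.Empty using (⊥-elim)
open import Data.Fin using (Fin; zero; suc)
import Data.Fin.Properties
open import Data.List
  using (List; []; _∷_; length; map; filter; cartesianProduct; cartesianProductWith; lookup; _++_)
open import Data.List.Membership.Propositional using (_∈_; lose)
open import Data.List.Membership.Propositional.Properties
  using (∈-cartesianProduct⁺; ∈-cartesianProduct⁻; ∈-cartesianProductWith⁺; ∈-filter⁺; ∈-filter⁻; ∈-map⁺; ∈-map⁻)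
open import Data.List.Membership.Propositional.Properties.WithK using (unique∧set⇒bag)
open import Data.List.Properties using (length-map; length-++)
open import Data.List.Relation.Binary.BagAndSetEquality using (∼bag⇒↭)
open import Data.List.Relation.Binary.Permutation.Propositional.Properties using (↭-length)
import Data.List.Relation.Unary.All as All
import Data.List.Relation.Unary.All.Properties as All
open import Data.List.Relation.Unary.AllPairs using ([]; _∷_)
import Data.List.Relation.Unary.Any as Any
open import Data.List.Relation.Unary.Any using (here; there; satisfied; index)
open import Data.List.Relation.Unary.Any.Properties using (lookup-index; any⁺; any⁻)
open import Data.List.Relation.Unary.Unique.Propositional using (Unique)
import Data.List.Relation.Unary.Unique.Propositional.Properties as Unique
open import Data.Nat
  using (ℕ; zero; suc; _+_; _*_; _^_; _≤_; _<_; _<?_; _∸_; pred; z<s; z≤n; s≤s; NonZero; >-nonZero)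
open import Data.Nat.Coprimality using (Coprime; coprime-divisor; coprime-+; 1-coprimeTo)
open import Data.Nat.Divisibility
open import Data.Nat.Induction using (<-wellFounded)
open import Data.Nat.Properties
open import Data.Product using (∃; _×_; _,_; proj₁; proj₂; uncurry)
open import Data.Sum using (inj₁; inj₂)
open import Data.Unit using (tt)
import Data.Vec as Vec
open import Data.Vec using (Vec; []; _∷_; zipWith)
open import Data.Vec.Properties
  using ( ∷-injective; zipWith-assoc; zipWith-identityˡ; zipWith-identityʳ; zipWith-inverseˡ; zipWith-inverseʳ
        ; zipWith-comm)
open import Function using (_∘_; id; _⇔_; mk⇔; Equivalence)
open import Induction.WellFounded using (Acc; acc)
open import Relation.Binary.Definitions using (DecidableEquality)
open import Relation.Binary.PropositionalEquality
open import Relation.Nullary using (¬_; Dec; yes; no)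
open import Relation.Nullary.Decidable using (T?; ⌊_⌋; toWitness; fromWitness; map′)

open import Defs

open CommutativeSemigroupProperties +-commutativeSemigroup using () renaming (interchange to +-interchange)
open Sum +-0-commutativeMonoid using (sum-syntax; sum-cong-≗; ∑-distrib-+; sum-replicate-zero)

T-ext : ∀ {a b} → (T a → T b) → (T b → T a) → a ≡ b
T-ext {false} {false} _ _ = refl
T-ext {false} {true}  _ g = ⊥-elim (g tt)
T-ext {true}  {false} f _ = ⊥-elim (f tt)
T-ext {true}  {true}  _ _ = refl

T-not⁺ : ∀ {a} → ¬ T a → T (not a)
T-not⁺ {false} _ = tt
T-not⁺ {true}  f = f tt

T-not⁻ : ∀ {a} → T (not a) → ¬ T a
T-not⁻ {false} _ ()

T-∧⁺ : ∀ {a b} → T a → T b → T (a ∧ b)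
T-∧⁺ ta tb = Equivalence.from T-∧ (ta , tb)

T-∧⁻ : ∀ {a b} → T (a ∧ b) → T a × T b
T-∧⁻ = Equivalence.to T-∧

indicator : Bool → ℕ
indicator false = 0
indicator true  = 1

anyᶠ : ∀ {n} → (Fin n → Bool) → Bool
anyᶠ {zero}  f = false
anyᶠ {suc n} f = f zero ∨ anyᶠ (f ∘ suc)

anyᶠ⁺ : ∀ {n} (f : Fin n → Bool) i → T (f i) → T (anyᶠ f)
anyᶠ⁺ f zero    t = Equivalence.from T-∨ (inj₁ t)
anyᶠ⁺ f (suc i) t = Equivalence.from T-∨ (inj₂ (anyᶠ⁺ (f ∘ suc) i t))

anyᶠ⁻ : ∀ {n} (f : Fin n → Bool) → T (anyᶠ f) → ∃ (T ∘ f)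
anyᶠ⁻ {suc n} f t with Equivalence.to T-∨ t
... | inj₁ t₀ = zero , t₀
... | inj₂ t₁ with anyᶠ⁻ (f ∘ suc) t₁
...   | i , tᵢ = suc i , tᵢ

Exclusive : ∀ {n} → (Fin n → Bool) → Set
Exclusive f = ∀ i j → T (f i) → T (f j) → i ≡ j

Exclusive-∘suc : ∀ {n} (f : Fin (suc n) → Bool) → Exclusive f → Exclusive (f ∘ suc)
Exclusive-∘suc f excl i j tᵢ tⱼ = Data.Fin.Properties.suc-injective (excl (suc i) (suc j) tᵢ tⱼ)

∑-indicator-exclusive : ∀ {n} (f : Fin n → Bool) → Exclusive f →
                        ∑[ i < n ] indicator (f i) ≡ indicator (anyᶠ f)
∑-indicator-exclusive {zero}  f _    = refl
∑-indicator-exclusive {suc n} f excl with f zero in f₀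
... | false = ∑-indicator-exclusive (f ∘ suc) (Exclusive-∘suc f excl)
... | true = cong suc (trans (∑-indicator-exclusive (f ∘ suc) (Exclusive-∘suc f excl)) rest-false)
  where
  rest-false : indicator (anyᶠ (f ∘ suc)) ≡ 0
  rest-false with anyᶠ (f ∘ suc) in any₁
  ... | false = refl
  ... | true with anyᶠ⁻ (f ∘ suc) (subst T (sym any₁) tt)
  ...   | i , tᵢ with excl zero (suc i) (subst T (sym f₀) tt) tᵢ
  ...     | ()

indicator-∧-anyᶠ : ∀ {n} h (f : Fin n → Bool) → (T h → Exclusive f) →
                   indicator (h ∧ anyᶠ f) ≡ ∑[ i < n ] indicator (f i ∧ h)
indicator-∧-anyᶠ {n} false f _ = sym (trans
  (sum-cong-≗ (λ i → cong indicator (∧-zeroʳ (f i)))) (sum-replicate-zero n))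
indicator-∧-anyᶠ true f excl = sym (trans
  (sum-cong-≗ (λ i → cong indicator (∧-identityʳ (f i)))) (∑-indicator-exclusive f (excl tt)))

enumerable⇒≡-dec : ∀ {A : Set} (xs : List A) → (∀ x → x ∈ xs) → DecidableEquality A
enumerable⇒≡-dec xs complete x y = map′
  (λ i≡j → trans (lookup-index (complete x)) (trans (cong (lookup xs) i≡j) (sym (lookup-index (complete y)))))
  (cong (index ∘ complete))
  (index (complete x) Data.Fin.≟ index (complete y))

length-cartesianProductWith : ∀ {A B C : Set} (f : A → B → C) xs ys →
                              length (cartesianProductWith f xs ys) ≡ length xs * length ys
length-cartesianProductWith f []       ys = refl
length-cartesianProductWith f (x ∷ xs) ys = begin
  length (map (f x) ys ++ cartesianProductWith f xs ys) ≡⟨ length-++ (map (f x) ys) ⟩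
  length (map (f x) ys) + length (cartesianProductWith f xs ys)
    ≡⟨ cong₂ _+_ (length-map (f x) ys) (length-cartesianProductWith f xs ys) ⟩
  length ys + length xs * length ys ∎
  where open ≡-Reasoning

map⁺-injectiveOn : ∀ {A B : Set} {f : A → B} {xs} → Unique xs →
                   (∀ {x y} → x ∈ xs → y ∈ xs → f x ≡ f y → x ≡ y) → Unique (map f xs)
map⁺-injectiveOn {xs = []}     []                 _   = []
map⁺-injectiveOn {xs = x ∷ xs} (x∉xs ∷ xs-unique) inj =
  All.map⁺ (All.tabulate λ y∈xs fx≡fy → All.lookup x∉xs y∈xs (inj (here refl) (there y∈xs) fx≡fy))
  ∷ map⁺-injectiveOn xs-unique (λ x∈ y∈ → inj (there x∈) (there y∈))

coprime-^-divisor : ∀ {m n} k {x} .{{_ : NonZero m}} → Coprime m n → m ^ k ∣ n * x → m ^ k ∣ x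
coprime-^-divisor zero    _   _ = 1∣ _
coprime-^-divisor {m} {n} (suc k) m⊥n m^[k+1]∣n*x
  with coprime-divisor m⊥n (∣-trans (m∣m*n (m ^ k)) m^[k+1]∣n*x)
... | divides z refl =
  subst (_∣ z * m) (*-comm (m ^ k) m) (*-monoˡ-∣ m (coprime-^-divisor k m⊥n m^k∣n*z))
  where
  m^k∣n*z : m ^ k ∣ n * z
  m^k∣n*z = *-cancelʳ-∣ m (subst₂ _∣_ (*-comm m (m ^ k)) (sym (*-assoc n z m)) m^[k+1]∣n*x)

^-monoʳ-∣ : ∀ m {n o} → n ≤ o → m ^ n ∣ m ^ o
^-monoʳ-∣ m {n} {o} n≤o = divides (m ^ (o ∸ n)) (begin
  m ^ o                ≡⟨ cong (m ^_) (sym (m+[n∸m]≡n n≤o)) ⟩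
  m ^ (n + (o ∸ n))    ≡⟨ ^-distribˡ-+-* m n (o ∸ n) ⟩
  m ^ n * m ^ (o ∸ n)  ≡⟨ *-comm (m ^ n) _ ⟩
  m ^ (o ∸ n) * m ^ n  ∎)
  where open ≡-Reasoning

∣-∑ : ∀ {d n} (f : Fin n → ℕ) → (∀ i → d ∣ f i) → d ∣ ∑[ i < n ] f i
∣-∑ {n = zero}  f _   = _ ∣0
∣-∑ {n = suc n} f d∣f = ∣m∣n⇒∣m+n (d∣f zero) (∣-∑ (f ∘ suc) (d∣f ∘ suc))

module _ {A : Set} where

  ∁ : (A → Bool) → A → Bool
  ∁ p x = not (p x)

  infixr 7 _∩_
  _∩_ : (A → Bool) → (A → Bool) → A → Bool
  (p ∩ r) x = p x ∧ r x

  count : (A → Bool) → List A → ℕ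
  count p []       = 0
  count p (x ∷ xs) = indicator (p x) + count p xs

  count-cong : ∀ {p r} → (∀ x → p x ≡ r x) → ∀ xs → count p xs ≡ count r xs
  count-cong p≗r []       = refl
  count-cong p≗r (x ∷ xs) = cong₂ _+_ (cong indicator (p≗r x)) (count-cong p≗r xs)

  count-split : ∀ p c xs → count p xs ≡ count (p ∩ c) xs + count (p ∩ ∁ c) xs
  count-split p c []       = refl
  count-split p c (x ∷ xs) = begin
    indicator (p x) + count p xs
      ≡⟨ cong₂ _+_ (indicator-split (p x) (c x)) (count-split p c xs) ⟩
    (indicator (p x ∧ c x) + indicator (p x ∧ not (c x))) + (count (p ∩ c) xs + count (p ∩ ∁ c) xs)
      ≡⟨ +-interchange (indicator (p x ∧ c x)) _ _ _ ⟩
    count (p ∩ c) (x ∷ xs) + count (p ∩ ∁ c) (x ∷ xs) ∎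
    where
    open ≡-Reasoning
    indicator-split : ∀ a b → indicator a ≡ indicator (a ∧ b) + indicator (a ∧ not b)
    indicator-split false _     = refl
    indicator-split true  false = refl
    indicator-split true  true  = refl

  count-∑ : ∀ {n} p (r : Fin n → A → Bool) →
            (∀ x → indicator (p x) ≡ ∑[ i < n ] indicator (r i x)) →
            ∀ xs → count p xs ≡ ∑[ i < n ] count (r i) xs
  count-∑ {n} p r pointwise []       = sym (sum-replicate-zero n)
  count-∑ {n} p r pointwise (x ∷ xs) = trans
    (cong₂ _+_ (pointwise x) (count-∑ p r pointwise xs))
    (sym (∑-distrib-+ (λ i → indicator (r i x)) (λ i → count (r i) xs)))

  count-mono : ∀ {p r} → (∀ x → T (p x) → T (r x)) → ∀ xs → count p xs ≤ count r xs
  count-mono p⊆r []       = z≤n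
  count-mono {p} {r} p⊆r (x ∷ xs) = +-mono-≤ (indicator-mono (p x) (r x) (p⊆r x)) (count-mono p⊆r xs)
    where
    indicator-mono : ∀ a b → (T a → T b) → indicator a ≤ indicator b
    indicator-mono false _     _ = z≤n
    indicator-mono true  true  _ = ≤-refl
    indicator-mono true  false f = ⊥-elim (f tt)

  count>0⇒∃ : ∀ p xs → 0 < count p xs → ∃ (T ∘ p)
  count>0⇒∃ p (x ∷ xs) pos with p x in px
  ... | true  = x , subst T (sym px) tt
  ... | false = count>0⇒∃ p xs pos

  ∈⇒count>0 : ∀ {p x xs} → x ∈ xs → T (p x) → 0 < count p xs
  ∈⇒count>0 {p} {xs = y ∷ ys} (here refl) px with p y
  ... | true = s≤s z≤n
  ∈⇒count>0 {p} {xs = y ∷ ys} (there x∈ys) px = ≤-trans (∈⇒count>0 x∈ys px) (m≤n+m _ (indicator (p y)))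

  count-true : ∀ xs → count (λ _ → true) xs ≡ length xs
  count-true []       = refl
  count-true (x ∷ xs) = cong suc (count-true xs)

  count-false : ∀ xs → count (λ _ → false) xs ≡ 0
  count-false []       = refl
  count-false (x ∷ xs) = count-false xs

  length-filter≡count : ∀ p xs → length (filter (T? ∘ p) xs) ≡ count p xs
  length-filter≡count p []       = refl
  length-filter≡count p (x ∷ xs) with p x
  ... | true  = cong suc (length-filter≡count p xs)
  ... | false = length-filter≡count p xs

module Universe {A : Set} (U : List A) (U-unique : Unique U) (U-complete : ∀ x → x ∈ U) where

  # : (A → Bool) → ℕ
  # p = count p U

  length≡# : ∀ {xs} p → Unique xs → (∀ x → x ∈ xs ⇔ T (p x)) → length xs ≡ # p
  length≡# {xs} p xs-unique xs≡p = begin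
    length xs                  ≡⟨ ↭-length (∼bag⇒↭ (unique∧set⇒bag xs-unique filter-unique same-elements)) ⟩
    length (filter (T? ∘ p) U) ≡⟨ length-filter≡count p U ⟩
    # p                        ∎
    where
    open ≡-Reasoning
    filter-unique : Unique (filter (T? ∘ p) U)
    filter-unique = Unique.filter⁺ (T? ∘ p) U-unique
    same-elements = λ {x} → mk⇔
      (λ x∈xs → ∈-filter⁺ (T? ∘ p) (U-complete x) (Equivalence.to (xs≡p x) x∈xs))
      (λ x∈p → Equivalence.from (xs≡p x) (proj₂ (∈-filter⁻ (T? ∘ p) {xs = U} x∈p)))

  #-true : # (λ _ → true) ≡ length U
  #-true = count-true U

module FiniteAbelianGroup
  (G : AbelianGroup 0ℓ 0ℓ) (≈⇒≡ : ∀ {x y} → AbelianGroup._≈_ G x y → x ≡ y)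
  (U : List (AbelianGroup.Carrier G)) (U-unique : Unique U) (U-complete : ∀ x → x ∈ U) where

  open AbelianGroup G using (Carrier; _∙_; ε; _⁻¹; _-_; assoc; inverseʳ; commutativeSemigroup)

  open Universe U U-unique U-complete public
  open AbelianGroupProperties G
    using (\\-leftDividesʳ; //-rightDividesˡ; //-rightDividesʳ; ⁻¹-anti-homo‿-; ⁻¹-∙-comm)
  open CommutativeSemigroupProperties commutativeSemigroup using (interchange)
  open ≡-Reasoning

  -‿chain : ∀ x y z → (x - y) ∙ (y - z) ≡ x - z
  -‿chain x y z = begin
    (x ∙ y ⁻¹) ∙ (y ∙ z ⁻¹) ≡⟨ ≈⇒≡ (assoc x (y ⁻¹) (y ∙ z ⁻¹)) ⟩
    x ∙ (y ⁻¹ ∙ (y ∙ z ⁻¹)) ≡⟨ cong (x ∙_) (≈⇒≡ (\\-leftDividesʳ y (z ⁻¹))) ⟩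
    x ∙ z ⁻¹                ∎

  -‿interchange : ∀ x y z w → (x - y) ∙ (z - w) ≡ (x ∙ z) - (y ∙ w)
  -‿interchange x y z w =
    trans (≈⇒≡ (interchange x (y ⁻¹) z (w ⁻¹))) (cong ((x ∙ z) ∙_) (≈⇒≡ (⁻¹-∙-comm y w)))

  ⁻¹-homo‿- : ∀ x y → (x - y) ⁻¹ ≡ x ⁻¹ - y ⁻¹
  ⁻¹-homo‿- x y = sym (≈⇒≡ (⁻¹-∙-comm x (y ⁻¹)))

  record IsSubgroup (W : Carrier → Bool) : Set where
    field
      ε-closed  : T (W ε)
      ∙-closed  : ∀ {x y} → T (W x) → T (W y) → T (W (x ∙ y))
      ⁻¹-closed : ∀ {x} → T (W x) → T (W (x ⁻¹))

    -‿closed : ∀ {x y} → T (W x) → T (W y) → T (W (x - y))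
    -‿closed Wx Wy = ∙-closed Wx (⁻¹-closed Wy)

  UnionOfCosets : (Carrier → Bool) → (Carrier → Bool) → Set
  UnionOfCosets W S = ∀ w x → T (W w) → T (S x) → T (S (w ∙ x))

  _⊆_ : (Carrier → Bool) → (Carrier → Bool) → Set
  p ⊆ r = ∀ x → T (p x) → T (r x)

  _∙ˢ_ : (Carrier → Bool) → (Carrier → Bool) → Carrier → Bool
  (B ∙ˢ W) x = any (λ b → B b ∧ W (x - b)) U

  ∙ˢ⁺ : ∀ B W {x} b → T (B b) → T (W (x - b)) → T ((B ∙ˢ W) x)
  ∙ˢ⁺ B W {x} b Bb Wx-b =
    any⁺ (λ b → B b ∧ W (x - b)) (lose (U-complete b) (T-∧⁺ Bb Wx-b))

  ∙ˢ⁻ : ∀ B W {x} → T ((B ∙ˢ W) x) → ∃ λ b → T (B b) × T (W (x - b))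
  ∙ˢ⁻ B W {x} t with satisfied (any⁻ (λ b → B b ∧ W (x - b)) U t)
  ... | b , BW = b , T-∧⁻ BW

  [x-t]∙t≡x : ∀ x t → (x - t) ∙ t ≡ x
  [x-t]∙t≡x x t = ≈⇒≡ (//-rightDividesˡ t x)

  [x∙t]-t≡x : ∀ x t → (x ∙ t) - t ≡ x
  [x∙t]-t≡x x t = ≈⇒≡ (//-rightDividesʳ t x)

  #-translate : ∀ p t → # (λ x → p (x - t)) ≡ # p
  #-translate p t = begin
    # (λ x → p (x - t))       ≡⟨ length≡# _ shifted-unique shifted-elements ⟨
    length (map (_∙ t) kept)  ≡⟨ length-map (_∙ t) kept ⟩
    length kept               ≡⟨ length-filter≡count p U ⟩
    # p                       ∎
    where
    kept = filter (T? ∘ p) U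
    shifted-unique : Unique (map (_∙ t) kept)
    shifted-unique = Unique.map⁺
      (λ {x} {y} xt≡yt → trans (sym ([x∙t]-t≡x x t)) (trans (cong (_- t) xt≡yt) ([x∙t]-t≡x y t)))
      (Unique.filter⁺ (T? ∘ p) U-unique)
    shifted-elements : ∀ x → x ∈ map (_∙ t) kept ⇔ T (p (x - t))
    shifted-elements x = mk⇔ to from
      where
      to : x ∈ map (_∙ t) kept → T (p (x - t))
      to x∈ with ∈-map⁻ (_∙ t) x∈
      ... | y , y∈kept , refl = subst (T ∘ p) (sym ([x∙t]-t≡x y t)) (proj₂ (∈-filter⁻ (T? ∘ p) {xs = U} y∈kept))
      from : T (p (x - t)) → x ∈ map (_∙ t) kept
      from px-t = subst (_∈ map (_∙ t) kept) ([x-t]∙t≡x x t)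
        (∈-map⁺ (_∙ t) (∈-filter⁺ (T? ∘ p) (U-complete (x - t)) px-t))

  whole : Carrier → Bool
  whole _ = true

  whole-isSubgroup : IsSubgroup whole
  whole-isSubgroup = record { ε-closed = tt ; ∙-closed = λ _ _ → tt ; ⁻¹-closed = λ _ → tt }

  ⊆-∙ˢ : ∀ B {W} → IsSubgroup W → B ⊆ (B ∙ˢ W)
  ⊆-∙ˢ B {W} W-sub x Bx =
    ∙ˢ⁺ B W x Bx (subst (T ∘ W) (sym (≈⇒≡ (inverseʳ x))) (IsSubgroup.ε-closed W-sub))

  ∙ˢ-union : ∀ {W} B → IsSubgroup W → UnionOfCosets W (B ∙ˢ W)
  ∙ˢ-union {W} B W-sub w x Ww B∙Wx with ∙ˢ⁻ B W B∙Wx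
  ... | b , Bb , Wx-b = ∙ˢ⁺ B W b Bb
    (subst (T ∘ W) (sym (≈⇒≡ (assoc w x (b ⁻¹)))) (IsSubgroup.∙-closed W-sub Ww Wx-b))

  ∙ˢ-isSubgroup : ∀ {B W} → IsSubgroup B → IsSubgroup W → IsSubgroup (B ∙ˢ W)
  ∙ˢ-isSubgroup {B} {W} B-sub W-sub = record
    { ε-closed  = ⊆-∙ˢ B W-sub ε (ε-closed B-sub)
    ; ∙-closed  = λ {x} {y} B∙Wx B∙Wy → closed-∙ (∙ˢ⁻ B W B∙Wx) (∙ˢ⁻ B W B∙Wy)
    ; ⁻¹-closed = λ {x} B∙Wx → closed-⁻¹ (∙ˢ⁻ B W B∙Wx)
    }
    where
    open IsSubgroup
    closed-∙ : ∀ {x y} → ∃ (λ b → T (B b) × T (W (x - b))) → ∃ (λ b → T (B b) × T (W (y - b))) →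
               T ((B ∙ˢ W) (x ∙ y))
    closed-∙ {x} {y} (b₁ , Bb₁ , Wx-b₁) (b₂ , Bb₂ , Wy-b₂) = ∙ˢ⁺ B W (b₁ ∙ b₂) (∙-closed B-sub Bb₁ Bb₂)
      (subst (T ∘ W) (-‿interchange x b₁ y b₂) (∙-closed W-sub Wx-b₁ Wy-b₂))
    closed-⁻¹ : ∀ {x} → ∃ (λ b → T (B b) × T (W (x - b))) → T ((B ∙ˢ W) (x ⁻¹))
    closed-⁻¹ {x} (b , Bb , Wx-b) = ∙ˢ⁺ B W (b ⁻¹) (⁻¹-closed B-sub Bb)
      (subst (T ∘ W) (⁻¹-homo‿- x b) (⁻¹-closed W-sub Wx-b))

  module _ {W B : Carrier → Bool} (W-sub : IsSubgroup W) (B-sub : IsSubgroup B) where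
    open IsSubgroup

    coset : Carrier → Carrier → Bool
    coset s x = W (x - s)

    coset⊆ : ∀ {S s} → UnionOfCosets W S → T (S s) → coset s ⊆ S
    coset⊆ {S} {s} S-union Ss x Wx-s = subst (T ∘ S) ([x-t]∙t≡x x s) (S-union (x - s) s Wx-s Ss)

    ∖coset-union : ∀ {S s} → UnionOfCosets W S → UnionOfCosets W (S ∩ ∁ (coset s))
    ∖coset-union {S} {s} S-union w x Ww S∖Cx =
      T-∧⁺ (S-union w x Ww Sx) (T-not⁺ λ Cwx →
        T-not⁻ ¬Cx (subst (T ∘ W) unshift (∙-closed W-sub (⁻¹-closed W-sub Ww) Cwx)))
      where
      Sx = proj₁ (T-∧⁻ S∖Cx)
      ¬Cx = proj₂ (T-∧⁻ S∖Cx)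
      unshift : w ⁻¹ ∙ ((w ∙ x) - s) ≡ x - s
      unshift = trans (cong (w ⁻¹ ∙_) (≈⇒≡ (assoc w x (s ⁻¹)))) (≈⇒≡ (\\-leftDividesʳ w (x - s)))

    #-∖coset : ∀ {S s} → UnionOfCosets W S → T (S s) → # S ≡ # W + # (S ∩ ∁ (coset s))
    #-∖coset {S} {s} S-union Ss = begin
      # S                                       ≡⟨ count-split S (coset s) U ⟩
      # (S ∩ coset s) + # (S ∩ ∁ (coset s))     ≡⟨ cong (_+ # (S ∩ ∁ (coset s))) (count-cong C∩S≡C U) ⟩
      # (coset s) + # (S ∩ ∁ (coset s))         ≡⟨ cong (_+ # (S ∩ ∁ (coset s))) (#-translate W s) ⟩
      # W + # (S ∩ ∁ (coset s))                 ∎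
      where
      C∩S≡C : ∀ x → (S ∩ coset s) x ≡ coset s x
      C∩S≡C x = T-ext (proj₂ ∘ T-∧⁻) (λ Cx → T-∧⁺ (coset⊆ S-union Ss x Cx) Cx)

    #-∩∖coset : ∀ {S s b} → UnionOfCosets W S → T (S s) → T (B b) → T (W (s - b)) →
                # (B ∩ S) ≡ # (B ∩ W) + # (B ∩ S ∩ ∁ (coset s))
    #-∩∖coset {S} {s} {b} S-union Ss Bb Ws-b = begin
      # (B ∩ S)
        ≡⟨ count-split (B ∩ S) (coset s) U ⟩
      # ((B ∩ S) ∩ coset s) + # ((B ∩ S) ∩ ∁ (coset s))
        ≡⟨ cong₂ _+_ (count-cong shift U) (count-cong reassoc U) ⟩
      # (λ x → (B ∩ W) (x - b)) + # (B ∩ S ∩ ∁ (coset s))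
        ≡⟨ cong (_+ # (B ∩ S ∩ ∁ (coset s))) (#-translate (B ∩ W) b) ⟩
      # (B ∩ W) + # (B ∩ S ∩ ∁ (coset s))
        ∎
      where
      reassoc : ∀ x → ((B ∩ S) ∩ ∁ (coset s)) x ≡ (B ∩ S ∩ ∁ (coset s)) x
      reassoc x = Data.Bool.Properties.∧-assoc (B x) (S x) _
      shift : ∀ x → ((B ∩ S) ∩ coset s) x ≡ (B ∩ W) (x - b)
      shift x = T-ext to from
        where
        to : T (((B ∩ S) ∩ coset s) x) → T ((B ∩ W) (x - b))
        to t = let (BSx , Wx-s) = T-∧⁻ t in
          T-∧⁺ (-‿closed B-sub (proj₁ (T-∧⁻ BSx)) Bb)
               (subst (T ∘ W) (-‿chain x s b) (∙-closed W-sub Wx-s Ws-b))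
        from : T ((B ∩ W) (x - b)) → T (((B ∩ S) ∩ coset s) x)
        from t = T-∧⁺ (T-∧⁺ Bx (coset⊆ S-union Ss x Wx-s)) Wx-s
          where
          Bx-b = proj₁ (T-∧⁻ t)
          Wx-b = proj₂ (T-∧⁻ t)
          Bx = subst (T ∘ B) ([x-t]∙t≡x x b) (∙-closed B-sub Bx-b Bb)
          Wb-s = subst (T ∘ W) (≈⇒≡ (⁻¹-anti-homo‿- s b)) (⁻¹-closed W-sub Ws-b)
          Wx-s = subst (T ∘ W) (-‿chain x b s) (∙-closed W-sub Wx-b Wb-s)

    #-∖coset-< : ∀ {S s} → UnionOfCosets W S → T (S s) → # (S ∩ ∁ (coset s)) < # S
    #-∖coset-< {S} {s} S-union Ss = subst (# (S ∩ ∁ (coset s)) <_) (sym (#-∖coset S-union Ss))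
      (m<n+m _ (∈⇒count>0 (U-complete ε) (ε-closed W-sub)))

    -- m is the number of W-cosets in S; each of them meets B in a translate of B ∩ W.
    coset-count : ∀ {S} → UnionOfCosets W S → S ⊆ (B ∙ˢ W) →
                  ∃ λ m → # S ≡ m * # W × # (B ∩ S) ≡ m * # (B ∩ W)
    coset-count {S} = go S (<-wellFounded (# S))
      where
      go : ∀ S → Acc _<_ (# S) → UnionOfCosets W S → S ⊆ (B ∙ˢ W) →
           ∃ λ m → # S ≡ m * # W × # (B ∩ S) ≡ m * # (B ∩ W)
      go S (acc smaller) S-union S⊆B∙W with 0 <? # S
      ... | no #S≯0 = 0 , n≤0⇒n≡0 (≮⇒≥ #S≯0)
                        , n≤0⇒n≡0 (≤-trans (count-mono (λ x → proj₂ ∘ T-∧⁻ {B x}) U) (≮⇒≥ #S≯0))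
      ... | yes #S>0 =
        let (s , Ss) = count>0⇒∃ S U #S>0
            (b , Bb , Ws-b) = ∙ˢ⁻ B W (S⊆B∙W s Ss)
            (m , #S′≡ , #B∩S′≡) = go (S ∩ ∁ (coset s)) (smaller (#-∖coset-< S-union Ss))
              (∖coset-union S-union) (λ x S∖Cx → S⊆B∙W x (proj₁ (T-∧⁻ S∖Cx)))
        in suc m , trans (#-∖coset S-union Ss) (cong (# W +_) #S′≡)
                 , trans (#-∩∖coset S-union Ss Bb Ws-b) (cong (# (B ∩ W) +_) #B∩S′≡)

  -- [B : B ∩ H] = [B ∙ˢ H : H], which divides [G : H] = i.
  index-∩ : ∀ {B H} → IsSubgroup B → IsSubgroup H → ∀ i → length U ≡ i * # H → # B ∣ i * # (B ∩ H)
  index-∩ {B} {H} B-sub H-sub i |U|≡i*#H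
    with coset-count H-sub B-sub (∙ˢ-union B H-sub) (λ _ B∙Hx → B∙Hx)
  ... | m , #B∙H≡ , #B∩B∙H≡
    with coset-count (∙ˢ-isSubgroup B-sub H-sub) whole-isSubgroup (λ _ _ _ _ → tt)
                     (⊆-∙ˢ whole (∙ˢ-isSubgroup B-sub H-sub))
  ... | m′ , #whole≡ , _ = divides m′ (begin
    i * # (B ∩ H)          ≡⟨ cong (_* # (B ∩ H)) i≡m′*m ⟩
    m′ * m * # (B ∩ H)     ≡⟨ *-assoc m′ m _ ⟩
    m′ * (m * # (B ∩ H))   ≡⟨ cong (m′ *_) (sym #B∩B∙H≡) ⟩
    m′ * # (B ∩ (B ∙ˢ H))  ≡⟨ cong (m′ *_) (count-cong B∩B∙H≡B U) ⟩
    m′ * # B               ∎)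
    where
    instance
      #H≢0 : NonZero (# H)
      #H≢0 = >-nonZero (∈⇒count>0 (U-complete ε) (IsSubgroup.ε-closed H-sub))
    i≡m′*m : i ≡ m′ * m
    i≡m′*m = *-cancelʳ-≡ i (m′ * m) (# H) (begin
      i * # H               ≡⟨ trans (sym |U|≡i*#H) (sym #-true) ⟩
      # whole               ≡⟨ #whole≡ ⟩
      m′ * # (B ∙ˢ H)       ≡⟨ cong (m′ *_) #B∙H≡ ⟩
      m′ * (m * # H)        ≡⟨ sym (*-assoc m′ m (# H)) ⟩
      m′ * m * # H          ∎)
    B∩B∙H≡B : ∀ x → (B ∩ (B ∙ˢ H)) x ≡ B x
    B∩B∙H≡B x = T-ext (proj₁ ∘ T-∧⁻) (λ Bx → T-∧⁺ Bx (⊆-∙ˢ B H-sub x Bx))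

module VectorSpace (F : FiniteField) where
  module F = FiniteField F
  open F using (Carrier; 0#; 1#; -_; ≈⇒≡; 0≢1; inverse; elems; elems-complete; elems-unique; q)
    renaming (_+_ to _+ᶠ_; _*_ to _*ᶠ_)
  open Geometry F

  infixl 6 _⊕_
  infixr 7 _⊙_
  infix 8 ⊖_

  _⊕_ : ∀ {n} → Vect n → Vect n → Vect n
  _⊕_ = zipWith _+ᶠ_

  ⊖_ : ∀ {n} → Vect n → Vect n
  ⊖_ = Vec.map -_

  _⊙_ : ∀ {n} → Carrier → Vect n → Vect n
  a ⊙ x = Vec.map (a *ᶠ_) x

  ⊕-isAbelianGroup : ∀ n → IsAbelianGroup _≡_ (_⊕_ {n}) zeroV ⊖_
  ⊕-isAbelianGroup n = record
    { isGroup = record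
      { isMonoid = record
        { isSemigroup = record
          { isMagma = record { isEquivalence = isEquivalence ; ∙-cong = cong₂ _⊕_ }
          ; assoc   = zipWith-assoc (λ a b c → ≈⇒≡ (F.+-assoc a b c)) }
        ; identity  = zipWith-identityˡ (≈⇒≡ ∘ F.+-identityˡ) , zipWith-identityʳ (≈⇒≡ ∘ F.+-identityʳ) }
      ; inverse = zipWith-inverseˡ (≈⇒≡ ∘ F.-‿inverseˡ) , zipWith-inverseʳ (≈⇒≡ ∘ F.-‿inverseʳ)
      ; ⁻¹-cong = cong ⊖_ }
    ; comm = zipWith-comm (λ a b → ≈⇒≡ (F.+-comm a b)) }

  vectorGroup : ℕ → AbelianGroup 0ℓ 0ℓ
  vectorGroup n = record { isAbelianGroup = ⊕-isAbelianGroup n }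

  private
    module ⊕ {n} = AbelianGroup (vectorGroup n)
    module ⊕-Properties {n} = AbelianGroupProperties (vectorGroup n)
    module ⊕-Semigroup {n} = CommutativeSemigroupProperties (⊕.commutativeSemigroup {n})

  private
    a*1≡a : ∀ a → a *ᶠ 1# ≡ a
    a*1≡a a = ≈⇒≡ (F.*-identityʳ a)

    a*0≡0 : ∀ a → a *ᶠ 0# ≡ 0#
    a*0≡0 a = ≈⇒≡ (F.zeroʳ a)

  ⊙-distribˡ-⊕ : ∀ {n} a (x y : Vect n) → a ⊙ (x ⊕ y) ≡ a ⊙ x ⊕ a ⊙ y
  ⊙-distribˡ-⊕ a []       []       = refl
  ⊙-distribˡ-⊕ a (x ∷ xs) (y ∷ ys) = cong₂ _∷_ (≈⇒≡ (F.distribˡ a x y)) (⊙-distribˡ-⊕ a xs ys)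

  ⊙-distribʳ-+ : ∀ {n} a b (x : Vect n) → (a +ᶠ b) ⊙ x ≡ a ⊙ x ⊕ b ⊙ x
  ⊙-distribʳ-+ a b []       = refl
  ⊙-distribʳ-+ a b (x ∷ xs) = cong₂ _∷_ (≈⇒≡ (F.distribʳ x a b)) (⊙-distribʳ-+ a b xs)

  ⊙-assoc : ∀ {n} a b (x : Vect n) → a ⊙ b ⊙ x ≡ (a *ᶠ b) ⊙ x
  ⊙-assoc a b []       = refl
  ⊙-assoc a b (x ∷ xs) = cong₂ _∷_ (sym (≈⇒≡ (F.*-assoc a b x))) (⊙-assoc a b xs)

  ⊙-identityˡ : ∀ {n} (x : Vect n) → 1# ⊙ x ≡ x
  ⊙-identityˡ []       = refl
  ⊙-identityˡ (x ∷ xs) = cong₂ _∷_ (≈⇒≡ (F.*-identityˡ x)) (⊙-identityˡ xs)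

  ⊙-zeroˡ : ∀ {n} (x : Vect n) → 0# ⊙ x ≡ zeroV
  ⊙-zeroˡ []       = refl
  ⊙-zeroˡ (x ∷ xs) = cong₂ _∷_ (≈⇒≡ (F.zeroˡ x)) (⊙-zeroˡ xs)

  ⊙-zeroʳ : ∀ {n} a → a ⊙ zeroV {n} ≡ zeroV
  ⊙-zeroʳ {zero}  a = refl
  ⊙-zeroʳ {suc n} a = cong₂ _∷_ (a*0≡0 a) (⊙-zeroʳ a)

  lincomb-zeroV : ∀ {v d} (B : Vec (Vect v) d) → lincomb zeroV B ≡ zeroV
  lincomb-zeroV []      = refl
  lincomb-zeroV (b ∷ B) = trans (cong₂ _⊕_ (⊙-zeroˡ b) (lincomb-zeroV B)) (⊕.identityˡ zeroV)

  lincomb-⊕ : ∀ {v d} (c c′ : Vec Carrier d) (B : Vec (Vect v) d) →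
              lincomb (c ⊕ c′) B ≡ lincomb c B ⊕ lincomb c′ B
  lincomb-⊕ []       []         []      = sym (⊕.identityˡ zeroV)
  lincomb-⊕ (a ∷ c) (a′ ∷ c′) (b ∷ B) = begin
    (a +ᶠ a′) ⊙ b ⊕ lincomb (c ⊕ c′) B                ≡⟨ cong₂ _⊕_ (⊙-distribʳ-+ a a′ b) (lincomb-⊕ c c′ B) ⟩
    (a ⊙ b ⊕ a′ ⊙ b) ⊕ (lincomb c B ⊕ lincomb c′ B)   ≡⟨ ⊕-Semigroup.interchange (a ⊙ b) _ _ _ ⟩
    (a ⊙ b ⊕ lincomb c B) ⊕ (a′ ⊙ b ⊕ lincomb c′ B)   ∎
    where open ≡-Reasoning

  lincomb-⊙ : ∀ {v d} a (c : Vec Carrier d) (B : Vec (Vect v) d) →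
              lincomb (a ⊙ c) B ≡ a ⊙ lincomb c B
  lincomb-⊙ a []      []      = sym (⊙-zeroʳ a)
  lincomb-⊙ a (x ∷ c) (b ∷ B) = begin
    (a *ᶠ x) ⊙ b ⊕ lincomb (a ⊙ c) B  ≡⟨ cong₂ _⊕_ (sym (⊙-assoc a x b)) (lincomb-⊙ a c B) ⟩
    a ⊙ x ⊙ b ⊕ a ⊙ lincomb c B       ≡⟨ sym (⊙-distribˡ-⊕ a _ _) ⟩
    a ⊙ (x ⊙ b ⊕ lincomb c B)         ∎
    where open ≡-Reasoning

  lincomb-⊖ : ∀ {v d} (c : Vec Carrier d) (B : Vec (Vect v) d) →
              lincomb (⊖ c) B ≡ ⊖ lincomb c B
  lincomb-⊖ c B = ⊕-Properties.inverseʳ-unique (lincomb c B) (lincomb (⊖ c) B) (begin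
    lincomb c B ⊕ lincomb (⊖ c) B  ≡⟨ sym (lincomb-⊕ c (⊖ c) B) ⟩
    lincomb (c ⊕ ⊖ c) B            ≡⟨ cong (λ c′ → lincomb c′ B) (⊕.inverseʳ c) ⟩
    lincomb zeroV B                ≡⟨ lincomb-zeroV B ⟩
    zeroV                          ∎)
    where open ≡-Reasoning

  lincomb-injective : ∀ {v} (S : Subspace v) {c c′} →
                      lincomb c (basis S) ≡ lincomb c′ (basis S) → c ≡ c′
  lincomb-injective S {c} {c′} same = ⊕-Properties.x∙y⁻¹≈ε⇒x≈y c c′ (indep S (c ⊕ ⊖ c′) (begin
    lincomb (c ⊕ ⊖ c′) (basis S)                    ≡⟨ lincomb-⊕ c (⊖ c′) (basis S) ⟩
    lincomb c (basis S) ⊕ lincomb (⊖ c′) (basis S)  ≡⟨ cong₂ _⊕_ same (lincomb-⊖ c′ (basis S)) ⟩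
    lincomb c′ (basis S) ⊕ ⊖ lincomb c′ (basis S)   ≡⟨ ⊕.inverseʳ _ ⟩
    zeroV                                           ∎))
    where open ≡-Reasoning

  ∈S-zeroV : ∀ {v} (S : Subspace v) → zeroV ∈S S
  ∈S-zeroV S = zeroV , lincomb-zeroV (basis S)

  ∈S-⊕ : ∀ {v} (S : Subspace v) {x y} → x ∈S S → y ∈S S → (x ⊕ y) ∈S S
  ∈S-⊕ S (c , refl) (c′ , refl) = c ⊕ c′ , lincomb-⊕ c c′ (basis S)

  ∈S-⊖ : ∀ {v} (S : Subspace v) {x} → x ∈S S → (⊖ x) ∈S S
  ∈S-⊖ S (c , refl) = ⊖ c , lincomb-⊖ c (basis S)

  ∈S-⊙ : ∀ {v} (S : Subspace v) a {x} → x ∈S S → (a ⊙ x) ∈S S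
  ∈S-⊙ S a (c , refl) = a ⊙ c , lincomb-⊙ a c (basis S)

  allV : ∀ n → List (Vect n)
  allV zero    = [] ∷ []
  allV (suc n) = cartesianProductWith _∷_ elems (allV n)

  allV-unique : ∀ n → Unique (allV n)
  allV-unique zero    = All.[] ∷ []
  allV-unique (suc n) = Unique.cartesianProductWith⁺ _∷_ ∷-injective elems-unique (allV-unique n)

  allV-complete : ∀ {n} (x : Vect n) → x ∈ allV n
  allV-complete []       = here refl
  allV-complete (a ∷ xs) = ∈-cartesianProductWith⁺ _∷_ (elems-complete a) (allV-complete xs)

  length-allV : ∀ n → length (allV n) ≡ q ^ n
  length-allV zero    = refl
  length-allV (suc n) =
    trans (length-cartesianProductWith _∷_ elems (allV n)) (cong (q *_) (length-allV n))

  _≟ᵥ_ : ∀ {n} → DecidableEquality (Vect n)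
  _≟ᵥ_ = enumerable⇒≡-dec (allV _) allV-complete

  _∈S?_ : ∀ {v} (x : Vect v) (S : Subspace v) → Dec (x ∈S S)
  x ∈S? S = map′ satisfied (λ (c , c↦x) → lose (allV-complete c) c↦x)
                 (Any.any? (λ c → lincomb c (basis S) ≟ᵥ x) (allV (dim S)))

  ⟦_⟧ : ∀ {v} → Subspace v → Vect v → Bool
  ⟦ S ⟧ x = ⌊ x ∈S? S ⌋

  ⟦⟧⁺ : ∀ {v} (S : Subspace v) {x} → x ∈S S → T (⟦ S ⟧ x)
  ⟦⟧⁺ S {x} = fromWitness {a? = x ∈S? S}

  ⟦⟧⁻ : ∀ {v} (S : Subspace v) {x} → T (⟦ S ⟧ x) → x ∈S S
  ⟦⟧⁻ S {x} = toWitness {a? = x ∈S? S}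

  _≟ᶠ_ : DecidableEquality Carrier
  _≟ᶠ_ = enumerable⇒≡-dec elems elems-complete

  isZero : Carrier → Bool
  isZero a = ⌊ a ≟ᶠ 0# ⌋

  nonzeros : List Carrier
  nonzeros = filter (T? ∘ ∁ isZero) elems

  ∈-nonzeros : ∀ a → a ∈ nonzeros ⇔ (¬ a ≡ 0#)
  ∈-nonzeros a = mk⇔
    (λ a∈ a≡0 → T-not⁻ (proj₂ (∈-filter⁻ (T? ∘ ∁ isZero) {xs = elems} a∈)) (fromWitness {a? = a ≟ᶠ 0#} a≡0))
    (λ a≢0 → ∈-filter⁺ (T? ∘ ∁ isZero) (elems-complete a) (T-not⁺ (a≢0 ∘ toWitness {a? = a ≟ᶠ 0#})))

  q≡1+|nonzeros| : q ≡ suc (length nonzeros)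
  q≡1+|nonzeros| = begin
    q                                            ≡⟨ sym (count-true elems) ⟩
    count (λ _ → true) elems                     ≡⟨ count-split (λ _ → true) isZero elems ⟩
    count isZero elems + count (∁ isZero) elems  ≡⟨ cong₂ _+_ #zero (sym (length-filter≡count _ elems)) ⟩
    suc (length nonzeros)                        ∎
    where
    open ≡-Reasoning
    open Universe elems elems-unique elems-complete using (length≡#)
    #zero : count isZero elems ≡ 1
    #zero = sym (length≡# isZero (All.[] ∷ []) λ a → mk⇔
      (λ { (here refl) → fromWitness {a? = 0# ≟ᶠ 0#} refl })
      (λ a≡0 → here (toWitness {a? = a ≟ᶠ 0#} a≡0)))

  instance
    q-nonZero : NonZero q
    q-nonZero = subst NonZero (sym q≡1+|nonzeros|) _

  q⊥|nonzeros| : Coprime q (length nonzeros)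
  q⊥|nonzeros| = subst (λ m → Coprime m (length nonzeros))
    (trans (+-comm (length nonzeros) 1) (sym q≡1+|nonzeros|)) (coprime-+ (1-coprimeTo _))

  ⊙-invertible : ∀ {a} → ¬ a ≡ 0# → ∃ λ b → ¬ b ≡ 0# × ∀ {n} (x : Vect n) → b ⊙ a ⊙ x ≡ x
  ⊙-invertible {a} a≢0 with inverse a a≢0
  ... | b , a*b≡1 = b , b≢0 , λ x → begin
    b ⊙ a ⊙ x      ≡⟨ ⊙-assoc b a x ⟩
    (b *ᶠ a) ⊙ x   ≡⟨ cong (_⊙ x) (trans (≈⇒≡ (F.*-comm b a)) a*b≡1) ⟩
    1# ⊙ x         ≡⟨ ⊙-identityˡ x ⟩
    x              ∎
    where
    open ≡-Reasoning
    b≢0 : ¬ b ≡ 0#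
    b≢0 b≡0 = 0≢1 (trans (sym (a*0≡0 a)) (trans (cong (a *ᶠ_) (sym b≡0)) a*b≡1))

  ⊙-injective : ∀ {n a} → ¬ a ≡ 0# → {x y : Vect n} → a ⊙ x ≡ a ⊙ y → x ≡ y
  ⊙-injective a≢0 {x} {y} ax≡ay with ⊙-invertible a≢0
  ... | b , _ , cancel = trans (sym (cancel x)) (trans (cong (b ⊙_) ax≡ay) (cancel y))

  ∈S-⊙⁻ : ∀ {v} (S : Subspace v) {a x} → ¬ a ≡ 0# → (a ⊙ x) ∈S S → x ∈S S
  ∈S-⊙⁻ S {x = x} a≢0 ax∈S with ⊙-invertible a≢0
  ... | b , _ , cancel = subst (_∈S S) (cancel x) (∈S-⊙ S b ax∈S)

  normalize : ∀ {n} (x : Vect n) → ¬ x ≡ zeroV → ∃ λ P → IsPoint P × ∃ λ a → ¬ a ≡ 0# × x ≡ a ⊙ P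
  normalize []       x≢0 = ⊥-elim (x≢0 refl)
  normalize (a ∷ xs) x≢0 with a ≟ᶠ 0#
  ... | yes refl =
    let (P , P-point , b , b≢0 , xs≡bP) = normalize xs (x≢0 ∘ cong (0# ∷_))
    in 0# ∷ P , there P-point , b , b≢0 , cong₂ _∷_ (sym (a*0≡0 b)) xs≡bP
  ... | no a≢0 =
    let (b , a*b≡1) = inverse a a≢0
    in 1# ∷ b ⊙ xs , here , a , a≢0 , cong₂ _∷_ (sym (a*1≡a a))
       (sym (trans (⊙-assoc a b xs) (trans (cong (_⊙ xs) a*b≡1) (⊙-identityˡ xs))))

  point-⊙-injective : ∀ {n a b} {P Q : Vect n} → ¬ a ≡ 0# → ¬ b ≡ 0# → IsPoint P → IsPoint Q →
                      a ⊙ P ≡ b ⊙ Q → a ≡ b × P ≡ Q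
  point-⊙-injective {a = a} {b} a≢0 _ here here aP≡bQ =
    let (a*1≡b*1 , axs≡bys) = ∷-injective aP≡bQ
        a≡b = trans (sym (a*1≡a a)) (trans a*1≡b*1 (a*1≡a b))
    in a≡b , cong (1# ∷_) (⊙-injective a≢0 (trans axs≡bys (cong (_⊙ _) (sym a≡b))))
  point-⊙-injective {a = a} {b} a≢0 _ here (there _) aP≡bQ =
    ⊥-elim (a≢0 (trans (sym (a*1≡a a)) (trans (proj₁ (∷-injective aP≡bQ)) (a*0≡0 b))))
  point-⊙-injective {a = a} {b} _ b≢0 (there _) here aP≡bQ =
    ⊥-elim (b≢0 (trans (sym (a*1≡a b)) (trans (sym (proj₁ (∷-injective aP≡bQ))) (a*0≡0 a))))
  point-⊙-injective a≢0 b≢0 (there P-point) (there Q-point) aP≡bQ =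
    let (a≡b , P≡Q) = point-⊙-injective a≢0 b≢0 P-point Q-point (proj₂ (∷-injective aP≡bQ))
    in a≡b , cong (0# ∷_) P≡Q

  module InDimension (v : ℕ) where
    open FiniteAbelianGroup (vectorGroup v) id (allV v) (allV-unique v) allV-complete public

    ⟦⟧-isSubgroup : (S : Subspace v) → IsSubgroup ⟦ S ⟧
    ⟦⟧-isSubgroup S = record
      { ε-closed  = ⟦⟧⁺ S (∈S-zeroV S)
      ; ∙-closed  = λ Sx Sy → ⟦⟧⁺ S (∈S-⊕ S (⟦⟧⁻ S Sx) (⟦⟧⁻ S Sy))
      ; ⁻¹-closed = λ Sx → ⟦⟧⁺ S (∈S-⊖ S (⟦⟧⁻ S Sx))
      }

    #⟦⟧ : (S : Subspace v) → # ⟦ S ⟧ ≡ q ^ dim S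
    #⟦⟧ S = begin
      # ⟦ S ⟧              ≡⟨ length≡# ⟦ S ⟧ span-unique span-elements ⟨
      length span          ≡⟨ length-map coordinates↦ (allV (dim S)) ⟩
      length (allV (dim S)) ≡⟨ length-allV (dim S) ⟩
      q ^ dim S            ∎
      where
      open ≡-Reasoning
      coordinates↦ = λ c → lincomb c (basis S)
      span = map coordinates↦ (allV (dim S))
      span-unique : Unique span
      span-unique = Unique.map⁺ (lincomb-injective S) (allV-unique (dim S))
      span-elements : ∀ x → x ∈ span ⇔ T (⟦ S ⟧ x)
      span-elements x = mk⇔
        (λ x∈span → let (c , _ , x≡) = ∈-map⁻ coordinates↦ x∈span in ⟦⟧⁺ S (c , sym x≡))
        (λ Sx → let (c , c↦x) = ⟦⟧⁻ S Sx in subst (_∈ span) c↦x (∈-map⁺ coordinates↦ (allV-complete c)))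

    #≡|nonzeros|*#points : (X : Vect v → Bool) → ¬ T (X zeroV) →
                         (∀ {a} x → ¬ a ≡ 0# → T (X x) → T (X (a ⊙ x))) →
                         ∀ {L} → Unique L → (∀ P → P ∈ L ⇔ (IsPoint P × T (X P))) →
                         # X ≡ length nonzeros * length L
    #≡|nonzeros|*#points X ¬X0 X-scaling {L} L-unique L-points = begin
      # X                       ≡⟨ length≡# X scaled-unique scaled-elements ⟨
      length scaled             ≡⟨ length-map (uncurry _⊙_) pairs ⟩
      length pairs              ≡⟨ length-cartesianProductWith _,_ nonzeros L ⟩
      length nonzeros * length L ∎
      where
      open ≡-Reasoning
      pairs = cartesianProduct nonzeros L
      scaled = map (uncurry _⊙_) pairs
      nonzero-point : ∀ {a P} → (a , P) ∈ pairs → ¬ a ≡ 0# × IsPoint P × T (X P)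
      nonzero-point a,P∈ = let (a∈ , P∈) = ∈-cartesianProduct⁻ nonzeros L a,P∈ in
        Equivalence.to (∈-nonzeros _) a∈ , Equivalence.to (L-points _) P∈
      scaled-unique : Unique scaled
      scaled-unique = map⁺-injectiveOn
        (Unique.cartesianProduct⁺ (Unique.filter⁺ (T? ∘ ∁ isZero) elems-unique) L-unique)
        λ {(a , P)} {(b , Q)} a,P∈ b,Q∈ aP≡bQ →
          let (a≢0 , P-point , _) = nonzero-point a,P∈
              (b≢0 , Q-point , _) = nonzero-point b,Q∈
              (a≡b , P≡Q) = point-⊙-injective a≢0 b≢0 P-point Q-point aP≡bQ
          in cong₂ _,_ a≡b P≡Q
      scaled-elements : ∀ x → x ∈ scaled ⇔ T (X x)
      scaled-elements x = mk⇔ to from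
        where
        to : x ∈ scaled → T (X x)
        to x∈ with ∈-map⁻ (uncurry _⊙_) x∈
        ... | (a , P) , a,P∈ , refl = let (a≢0 , _ , XP) = nonzero-point a,P∈ in X-scaling P a≢0 XP
        from : T (X x) → x ∈ scaled
        from Xx with normalize x (λ x≡0 → ¬X0 (subst (T ∘ X) x≡0 Xx))
        ... | P , P-point , a , a≢0 , refl with ⊙-invertible a≢0
        ...   | b , b≢0 , cancel = ∈-map⁺ (uncurry _⊙_) (∈-cartesianProduct⁺
          (Equivalence.from (∈-nonzeros a) a≢0)
          (Equivalence.from (L-points P) (P-point , subst (T ∘ X) (cancel P) (X-scaling (a ⊙ P) b≢0 Xx))))

  module Hyperplane {u} (H : Subspace (suc u)) (H-hyperplane : IsHyperplane H) where
    open InDimension (suc u)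

    #H : # ⟦ H ⟧ ≡ q ^ u
    #H = trans (#⟦⟧ H) (cong (q ^_) H-hyperplane)

    |V|≡q*#H : length (allV (suc u)) ≡ q * # ⟦ H ⟧
    |V|≡q*#H = trans (length-allV (suc u)) (cong (q *_) (sym #H))

    ∁hyperplane-divisible : ∀ {k} → k ≤ u → q ^ k ∣ # (∁ ⟦ H ⟧)
    ∁hyperplane-divisible {k} k≤u = ∣m+n∣m⇒∣n q^k∣#H+#∁H (subst (q ^ k ∣_) (sym #H) (^-monoʳ-∣ q k≤u))
      where
      q^k∣#H+#∁H : q ^ k ∣ # ⟦ H ⟧ + # (∁ ⟦ H ⟧)
      q^k∣#H+#∁H = subst (q ^ k ∣_)
        (trans (sym (trans #-true (length-allV (suc u)))) (count-split whole ⟦ H ⟧ (allV (suc u))))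
        (^-monoʳ-∣ q (m≤n⇒m≤1+n k≤u))

    ∖hyperplane-divisible : ∀ {k} (B : Subspace (suc u)) → k < dim B → q ^ k ∣ # (⟦ B ⟧ ∩ ∁ ⟦ H ⟧)
    ∖hyperplane-divisible {k} B k<dim = ∣-trans (^-monoʳ-∣ q k≤e) (∣m+n∣m⇒∣n q^e∣#B q^e∣#B∩H)
      where
      e = pred (dim B)
      k≤e : k ≤ e
      k≤e = <⇒≤pred k<dim
      #B≡q^[1+e] : # ⟦ B ⟧ ≡ q ^ suc e
      #B≡q^[1+e] = trans (#⟦⟧ B) (cong (q ^_) (sym (suc-pred (dim B) {{>-nonZero (<-≤-trans z<s k<dim)}})))
      q^e∣#B∩H : q ^ e ∣ # (⟦ B ⟧ ∩ ⟦ H ⟧)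
      q^e∣#B∩H = *-cancelˡ-∣ q (subst (_∣ q * # (⟦ B ⟧ ∩ ⟦ H ⟧)) #B≡q^[1+e]
        (index-∩ (⟦⟧-isSubgroup B) (⟦⟧-isSubgroup H) q |V|≡q*#H))
      q^e∣#B : q ^ e ∣ # (⟦ B ⟧ ∩ ⟦ H ⟧) + # (⟦ B ⟧ ∩ ∁ ⟦ H ⟧)
      q^e∣#B = subst (q ^ e ∣_) (trans (sym #B≡q^[1+e]) (count-split ⟦ B ⟧ ⟦ H ⟧ (allV (suc u))))
        (n∣m*n q)

module Partition
  (F : FiniteField) {u n : ℕ}
  (𝒫 : Fin n → Geometry.Subspace F (suc u)) (𝒫-partition : Geometry.IsVSPartition F 𝒫) (k : ℕ)
  (H : Geometry.Subspace F (suc u)) (H-hyperplane : Geometry.IsHyperplane F H) where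

  open Geometry F

  open FiniteField F using (q; 0#)
  open VectorSpace F
  open InDimension (suc u)
  open Hyperplane H H-hyperplane
  open IsVSPartition 𝒫-partition

  inLarge : Fin n → Vect (suc u) → Bool
  inLarge i x = ⌊ k <? dim (𝒫 i) ⌋ ∧ ⟦ 𝒫 i ⟧ x

  inSomeLarge : Vect (suc u) → Bool
  inSomeLarge x = anyᶠ (λ i → inLarge i x)

  -- A nonzero vector lies in exactly one element, so lying in no large element means that its point
  -- lies in 𝓗_k.
  Hₖ∖H : Vect (suc u) → Bool
  Hₖ∖H = ∁ ⟦ H ⟧ ∩ ∁ inSomeLarge

  ∁H⇒≢zeroV : ∀ {x} → T (∁ ⟦ H ⟧ x) → ¬ x ≡ zeroV
  ∁H⇒≢zeroV ∁Hx refl = T-not⁻ ∁Hx (⟦⟧⁺ H (∈S-zeroV H))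

  element-unique : ∀ {x i j} → ¬ x ≡ zeroV → x ∈S 𝒫 i → x ∈S 𝒫 j → i ≡ j
  element-unique {x} {i} {j} x≢0 x∈i x∈j with normalize x x≢0
  ... | P , P-point , a , a≢0 , refl = unique P P-point i j (∈S-⊙⁻ (𝒫 i) a≢0 x∈i) (∈S-⊙⁻ (𝒫 j) a≢0 x∈j)

  inLarge-exclusive : ∀ {x} → T (∁ ⟦ H ⟧ x) → Exclusive (λ i → inLarge i x)
  inLarge-exclusive ∁Hx i j large-i large-j = element-unique (∁H⇒≢zeroV ∁Hx)
    (⟦⟧⁻ (𝒫 i) (proj₂ (T-∧⁻ large-i))) (⟦⟧⁻ (𝒫 j) (proj₂ (T-∧⁻ large-j)))

  #∁H≡ : # (∁ ⟦ H ⟧) ≡ ∑[ i < n ] # (inLarge i ∩ ∁ ⟦ H ⟧) + # Hₖ∖H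
  #∁H≡ = trans (count-split (∁ ⟦ H ⟧) inSomeLarge (allV (suc u)))
    (cong (_+ # Hₖ∖H) (count-∑ _ (λ i → inLarge i ∩ ∁ ⟦ H ⟧)
      (λ x → indicator-∧-anyᶠ (∁ ⟦ H ⟧ x) (λ i → inLarge i x) inLarge-exclusive) (allV (suc u))))

  inLarge∖H-divisible : ∀ i → q ^ k ∣ # (inLarge i ∩ ∁ ⟦ H ⟧)
  inLarge∖H-divisible i = divisible (k <? dim (𝒫 i))
    where
    divisible : (large? : Dec (k < dim (𝒫 i))) → q ^ k ∣ # (λ x → (⌊ large? ⌋ ∧ ⟦ 𝒫 i ⟧ x) ∧ not (⟦ H ⟧ x))
    divisible (yes k<dim) = ∖hyperplane-divisible (𝒫 i) k<dim
    divisible (no _)      = subst (q ^ k ∣_) (sym (count-false (allV (suc u)))) (_ ∣0)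

  Hₖ∖H-divisible : k ≤ u → q ^ k ∣ # Hₖ∖H
  Hₖ∖H-divisible k≤u = ∣m+n∣m⇒∣n (subst (q ^ k ∣_) #∁H≡ (∁hyperplane-divisible k≤u))
    (∣-∑ _ inLarge∖H-divisible)

  Hₖ∖H-scaling : ∀ {a} x → ¬ a ≡ 0# → T (Hₖ∖H x) → T (Hₖ∖H (a ⊙ x))
  Hₖ∖H-scaling {a} x a≢0 Hₖ∖H-x =
    T-∧⁺ (T-not⁺ λ H-ax → T-not⁻ ∁Hx (⟦⟧⁺ H (∈S-⊙⁻ H a≢0 (⟦⟧⁻ H H-ax))))
         (T-not⁺ λ large-ax → T-not⁻ ∁Lx (unscale (anyᶠ⁻ _ large-ax)))
    where
    ∁Hx = proj₁ (T-∧⁻ Hₖ∖H-x)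
    ∁Lx = proj₂ (T-∧⁻ Hₖ∖H-x)
    unscale : ∃ (λ i → T (inLarge i (a ⊙ x))) → T (inSomeLarge x)
    unscale (i , large-ax) = let (large , ax∈) = T-∧⁻ large-ax in
      anyᶠ⁺ _ i (T-∧⁺ large (⟦⟧⁺ (𝒫 i) (∈S-⊙⁻ (𝒫 i) a≢0 (⟦⟧⁻ (𝒫 i) ax∈))))

  point-∉large : ∀ {P} → IsPoint P → T (∁ inSomeLarge P) ⇔ (∃ λ i → P ∈S 𝒫 i × dim (𝒫 i) ≤ k)
  point-∉large {P} P-point = mk⇔ to from
    where
    to : T (∁ inSomeLarge P) → ∃ λ i → P ∈S 𝒫 i × dim (𝒫 i) ≤ k
    to ∁LP = let (i , P∈i) = cover P P-point in i , P∈i , ≮⇒≥ λ k<dim →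
      T-not⁻ ∁LP (anyᶠ⁺ _ i (T-∧⁺ (fromWitness {a? = k <? dim (𝒫 i)} k<dim) (⟦⟧⁺ (𝒫 i) P∈i)))
    from : (∃ λ i → P ∈S 𝒫 i × dim (𝒫 i) ≤ k) → T (∁ inSomeLarge P)
    from (j , P∈j , dim≤k) = T-not⁺ λ LP →
      let (i , large-P) = anyᶠ⁻ _ LP
          (large , P∈i) = T-∧⁻ large-P
          i≡j = unique P P-point i j (⟦⟧⁻ (𝒫 i) P∈i) P∈j
      in <⇒≱ (toWitness {a? = k <? dim (𝒫 i)} large) (subst (λ i → dim (𝒫 i) ≤ k) (sym i≡j) dim≤k)

  #Hₖ∖H : ∀ {L} → Unique L →
          (∀ P → (P ∈ L → IsPoint P × InHk 𝒫 k P × ¬ (P ∈S H)) ×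
                 (IsPoint P × InHk 𝒫 k P × ¬ (P ∈S H) → P ∈ L)) →
          # Hₖ∖H ≡ length nonzeros * length L
  #Hₖ∖H L-unique L-spec = #≡|nonzeros|*#points Hₖ∖H
    (λ Hₖ∖H-0 → ∁H⇒≢zeroV (proj₁ (T-∧⁻ Hₖ∖H-0)) refl) Hₖ∖H-scaling L-unique
    λ P → mk⇔
      (λ P∈L → let (P-point , (_ , small) , P∉H) = proj₁ (L-spec P) P∈L in
        P-point , T-∧⁺ (T-not⁺ (P∉H ∘ ⟦⟧⁻ H)) (Equivalence.from (point-∉large P-point) small))
      (λ (P-point , Hₖ∖H-P) → let (∁HP , ∁LP) = T-∧⁻ Hₖ∖H-P in
        proj₂ (L-spec P) (P-point , (P-point , Equivalence.to (point-∉large P-point) ∁LP)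
                                  , λ P∈H → T-not⁻ ∁HP (⟦⟧⁺ H P∈H)))

corollary2 : (F : FiniteField) →
    ∀ (v n : ℕ) (𝒫 : Fin n → Geometry.Subspace F v) → Geometry.IsVSPartition F 𝒫 →
    ∀ (k : ℕ) → 1 ≤ k →
    (∃ λ i → k < Geometry.dim (𝒫 i)) →
    Geometry.Divisible F (FiniteField.q F ^ k) (Geometry.InHk F 𝒫 k)
corollary2 F zero n 𝒫 𝒫-partition k _ (i , _) = ⊥-elim (n≮0 (Geometry.IsVSPartition.dim-lt 𝒫-partition i))
corollary2 F (suc u) n 𝒫 𝒫-partition k _ (i , k<dim) H H-hyperplane L L-unique L-spec =
  coprime-^-divisor k q⊥|nonzeros|
    (subst (q ^ k ∣_) (#Hₖ∖H L-unique L-spec) (Hₖ∖H-divisible k≤u))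
  where
  open FiniteField F using (q)
  open VectorSpace F using (q⊥|nonzeros|; q-nonZero)
  open Partition F 𝒫 𝒫-partition k H H-hyperplane
  k≤u : k ≤ u
  k≤u = ≤-pred (<-trans k<dim (Geometry.IsVSPartition.dim-lt 𝒫-partition i))
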